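{- For every integer $q>2$, there exists a $K_q$-booster $B$ with disjoint $K_q$-decompositions $\mathcal{B}_1$ and $\mathcal{B}_2$, and cliques $S_1\in\mathcal{B}_1$, $S_2\in\mathcal{B}_2$ with $|V(S_1)\cap V(S_2)|=q-1$, such that $m(\mathcal{B}_1\setminus\{S_1\},V(S_1))\leq 2/(q-2)$ and $m(\mathcal{B}_2\setminus\{S_2\},V(S_1)\cup V(S_2))\leq 2/(q-2)$.
   Context: A $K_q$-booster is a graph $B$ together with two $K_q$-decompositions $\mathcal{B}_1,\mathcal{B}_2$ of $B$ (each a set of pairwise edge-disjoint copies of $K_q$ in $B$ covering all edges of $B$) with $\mathcal{B}_1\cap\mathcal{B}_2=\emptyset$. For a set $\mathcal{H}$ of copies of $K_q$ and a vertex set $R$, $d(\mathcal{H},R):=|\mathcal{H}|\big/\big|\bigcup_{H\in\mathcal{H}}V(H)\setminus R\big|$ and $m(\mathcal{H},R):=\max_{\mathcal{H}'\subseteq\mathcal{H}}d(\mathcal{H}',R)$ (the empty subfamily being taken to have density $0$). -}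

module Defs where

open import Data.Nat using (ℕ; _≤_; _*_)
open import Data.Fin using (Fin)
open import Data.Fin.Subset using (Subset; _∈_; _∩_; _∪_; _─_; ∣_∣; ⊥)
open import Data.Bool using (Bool; true)
open import Data.List using (List; []; _∷_; foldr; length)
open import Data.List.Relation.Unary.All using (All)
open import Data.List.Relation.Unary.Any using (Any)
open import Data.List.Relation.Unary.AllPairs using (AllPairs)
open import Data.List.Relation.Binary.Sublist.Propositional using (_⊆_)
import Data.List.Membership.Propositional as LM
open import Data.Product using (_×_)
open import Data.Empty renaming (⊥ to Empty)
open import Relation.Binary.PropositionalEquality using (_≡_; _≢_)

record IsGraph {n : ℕ} (E : Fin n → Fin n → Bool) : Set where
  field
    symmetric   : ∀ u v → E u v ≡ true → E v u ≡ true
    irreflexive : ∀ u → E u u ≡ true → Empty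

-- A copy of K_q is represented by its vertex set (a q-subset); it is a copy of
-- K_q in the graph E if all pairs of distinct vertices of it are edges of E.
IsCliqueIn : ∀ {n} → (Fin n → Fin n → Bool) → Subset n → Set
IsCliqueIn E S = ∀ u v → u ∈ S → v ∈ S → u ≢ v → E u v ≡ true

IsKqIn : ∀ {n} → ℕ → (Fin n → Fin n → Bool) → Subset n → Set
IsKqIn q E S = (∣ S ∣ ≡ q) × IsCliqueIn E S

EdgeDisjoint : ∀ {n} → Subset n → Subset n → Set
EdgeDisjoint S T = ∀ u v → u ≢ v → u ∈ S → v ∈ S → u ∈ T → v ∈ T → Empty

-- A K_q-decomposition of E: a family (list, pairwise edge-disjoint hence without
-- repetitions) of copies of K_q in E covering every edge of E.
IsKqDecomposition : ∀ {n} → ℕ → (Fin n → Fin n → Bool) → List (Subset n) → Set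
IsKqDecomposition q E L =
  All (IsKqIn q E) L ×
  AllPairs EdgeDisjoint L ×
  (∀ u v → E u v ≡ true → Any (λ S → (u ∈ S) × (v ∈ S)) L)

DisjointFamilies : ∀ {n} → List (Subset n) → List (Subset n) → Set
DisjointFamilies L M = ∀ S → S LM.∈ L → S LM.∈ M → Empty

⋃V : ∀ {n} → List (Subset n) → Subset n
⋃V = foldr _∪_ ⊥

-- d(H,R) ≤ a/b, written cross-multiplied:  |H| * b ≤ a * |⋃V(H) \ R|.
-- (When the denominator is 0 and H is nonempty, d is +∞ and this correctly fails
--  for b > 0; for H empty, d = 0.)
DensityLE : ∀ {n} → List (Subset n) → Subset n → ℕ → ℕ → Set
DensityLE H R a b = length H * b ≤ a * ∣ ⋃V H ─ R ∣

MaxDensityLE : ∀ {n} → List (Subset n) → Subset n → ℕ → ℕ → Set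
MaxDensityLE H R a b = ∀ H′ → H′ ⊆ H → DensityLE H′ R a b

{-# OPTIONS --safe #-}
module Submission where

-- Write q = p + 1 and m = q - 2.  The booster lives on a clique X = {x_1, ..., x_p}, two
-- non-adjacent apexes a, a′ and a p × m grid of vertices w_ir forming a rook's graph
-- (below: X i, apex true, apex false, W i r).  Besides these edges, x_i is joined to its
-- grid row and both apexes are joined to X and to the whole grid.  The first decomposition
-- consists of the hub S₁ = X ∪ {a}, the rows {x_i, a′} ∪ row i and the columns
-- {a} ∪ column r, all of size q; exchanging a and a′ gives the second one, with hub
-- S₂ = X ∪ {a′}.  Every non-hub clique has at least m vertices in the grid, the grid avoids
-- S₁ ∪ S₂, and each grid vertex lies in exactly two non-hub cliques of a decomposition (its
-- row and its column).  Double counting therefore gives |H| m ≤ 2 |⋃H ∖ (S₁ ∪ S₂)| for every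
-- family H of non-hub cliques.

open import Defs
open import Data.Bool using (Bool; true; false; not; _∧_; _∨_; _xor_)
import Data.Bool.Properties as Bool
open import Data.Bool.Properties using (not-¬; ¬-not)
open import Data.Empty using (⊥; ⊥-elim)
open import Data.Fin using (Fin; zero; suc; _↑ˡ_; _↑ʳ_; splitAt; join; combine; remQuot)
open import Data.Fin.Properties
  using (_≟_; splitAt-↑ˡ; splitAt-↑ʳ; join-splitAt; remQuot-combine; combine-remQuot)
open import Data.Fin.Subset using (Subset; _∈_; _∩_; _∪_; _─_; ∣_∣)
open import Data.List using (List; []; _∷_; _++_; map; length)
import Data.List as List
open import Data.List.Properties using (map-++; map-tabulate; length-map)
import Data.List.Membership.Propositional as Mem
open import Data.List.Membership.Propositional.Properties
  using (∈-map⁻; ∈-++⁺ˡ; ∈-++⁺ʳ; ∈-tabulate⁺)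
open import Data.List.Relation.Binary.Sublist.Propositional
  using ([]; _∷_; _∷ʳ_) renaming (_⊆_ to _⊑_)
open import Data.List.Relation.Binary.Sublist.Propositional.Properties using (All-resp-⊆)
open import Data.List.Relation.Unary.All using (All; []; _∷_; universal)
import Data.List.Relation.Unary.All.Properties as All
open import Data.List.Relation.Unary.AllPairs using (AllPairs; _∷_)
import Data.List.Relation.Unary.AllPairs.Properties as AllPairs
import Data.List.Relation.Unary.Any as Any
import Data.List.Relation.Unary.Any.Properties as Any
open import Data.Nat using (ℕ; zero; suc; _+_; _*_; _≤_; _<_; _∸_; z≤n; s≤s)
open import Data.Nat.Properties
  using ( +-*-semiring; +-comm; +-assoc; +-identityʳ; *-identityʳ
        ; ≤-reflexive; ≤-trans; +-mono-≤; +-monoʳ-≤; m≤n+m; n≤1+n; module ≤-Reasoning)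
open import Algebra.Properties.Semiring.Sum +-*-semiring
  using (sum-syntax; sum-cong-≗; sum-replicate-zero; ∑-comm; ∑-distrib-+; *-distribˡ-sum)
open import Data.Product using (Σ; ∃; _×_; _,_; uncurry)
open import Data.Sum using (_⊎_; inj₁; inj₂; [_,_])
open import Data.Vec using ([]; _∷_; lookup; tabulate)
open import Data.Vec.Properties using (lookup∘tabulate; lookup-zipWith; []=⇒lookup; lookup⇒[]=)
open import Function using (_∘_; _on_)
open import Function.Bundles using (mk⇔)
open import Relation.Binary.PropositionalEquality
  using (_≡_; _≢_; refl; sym; trans; cong; cong₂; subst; ≢-sym; module ≡-Reasoning)
open import Relation.Nullary.Decidable
  using (Dec; does; yes; no; dec-true; dec-false; does-⇔)
open import Relation.Nullary.Negation using (contradiction)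

⟦_⟧ : Bool → ℕ
⟦ true ⟧  = 1
⟦ false ⟧ = 0

dec-true⁻ : ∀ {a} {A : Set a} (a? : Dec A) → does a? ≡ true → A
dec-true⁻ (yes a) _ = a

does-≟-sym : ∀ {n} (i j : Fin n) → does (i ≟ j) ≡ does (j ≟ i)
does-≟-sym i j = does-⇔ (mk⇔ sym sym) (i ≟ j) (j ≟ i)

∑-mono-≤ : ∀ {n} {f g : Fin n → ℕ} → (∀ i → f i ≤ g i) → ∑[ i < n ] f i ≤ ∑[ i < n ] g i
∑-mono-≤ {zero}  f≤g = z≤n
∑-mono-≤ {suc n} f≤g = +-mono-≤ (f≤g zero) (∑-mono-≤ (f≤g ∘ suc))

∑-const-1 : ∀ n → ∑[ i < n ] 1 ≡ n
∑-const-1 zero    = refl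
∑-const-1 (suc n) = cong suc (∑-const-1 n)

∑-↑ : ∀ m n (f : Fin (m + n) → ℕ) →
      ∑[ i < m + n ] f i ≡ ∑[ i < m ] f (i ↑ˡ n) + ∑[ j < n ] f (m ↑ʳ j)
∑-↑ zero    n f = refl
∑-↑ (suc m) n f = trans (cong (f zero +_) (∑-↑ m n (f ∘ suc))) (sym (+-assoc (f zero) _ _))

∑-combine : ∀ m n (f : Fin (m * n) → ℕ) →
            ∑[ k < m * n ] f k ≡ ∑[ i < m ] ∑[ j < n ] f (combine i j)
∑-combine zero    n f = refl
∑-combine (suc m) n f = trans (∑-↑ n (m * n) f)
  (cong (∑[ j < n ] f (j ↑ˡ m * n) +_) (∑-combine m n (f ∘ (n ↑ʳ_))))

∑-does-≟ : ∀ {n} (i : Fin n) → ∑[ j < n ] ⟦ does (j ≟ i) ⟧ ≡ 1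
∑-does-≟ {suc n} zero    = cong suc (sum-replicate-zero n)
∑-does-≟ {suc n} (suc i) = ∑-does-≟ i

∑-does-≟′ : ∀ {n} (i : Fin n) → ∑[ j < n ] ⟦ does (i ≟ j) ⟧ ≡ 1
∑-does-≟′ i = trans (sum-cong-≗ (λ j → cong ⟦_⟧ (does-≟-sym i j))) (∑-does-≟ i)

∣∣≡∑ : ∀ {n} (S : Subset n) → ∣ S ∣ ≡ ∑[ u < n ] ⟦ lookup S u ⟧
∣∣≡∑ []          = refl
∣∣≡∑ (true ∷ S)  = cong suc (∣∣≡∑ S)
∣∣≡∑ (false ∷ S) = ∣∣≡∑ S

lookup-─ : ∀ {n} (S R : Subset n) u → lookup R u ≡ false → lookup (S ─ R) u ≡ lookup S u
lookup-─ (_ ∷ S) (false ∷ R) zero    _   = refl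
lookup-─ (_ ∷ S) (_ ∷ R)     (suc u) u∉R = lookup-─ S R u u∉R

occurrences : ∀ {n} → List (Subset n) → Fin n → ℕ
occurrences []      u = 0
occurrences (S ∷ L) u = ⟦ lookup S u ⟧ + occurrences L u

occurrences-++ : ∀ {n} (H L : List (Subset n)) u →
                 occurrences (H ++ L) u ≡ occurrences H u + occurrences L u
occurrences-++ []      L u = refl
occurrences-++ (S ∷ H) L u =
  trans (cong (⟦ lookup S u ⟧ +_) (occurrences-++ H L u)) (sym (+-assoc ⟦ lookup S u ⟧ _ _))

occurrences-tabulate : ∀ {n a} (F : Fin a → Subset n) u →
                       occurrences (List.tabulate F) u ≡ ∑[ i < a ] ⟦ lookup (F i) u ⟧
occurrences-tabulate {a = zero}  F u = refl
occurrences-tabulate {a = suc a} F u =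
  cong (⟦ lookup (F zero) u ⟧ +_) (occurrences-tabulate (F ∘ suc) u)

occurrences-mono : ∀ {n} {H L : List (Subset n)} u → H ⊑ L → occurrences H u ≤ occurrences L u
occurrences-mono u []           = z≤n
occurrences-mono u (S ∷ʳ H⊑L)   = ≤-trans (occurrences-mono u H⊑L) (m≤n+m _ _)
occurrences-mono u (refl ∷ H⊑L) = +-monoʳ-≤ _ (occurrences-mono u H⊑L)

occurrences-outside-⋃V : ∀ {n} (H : List (Subset n)) u →
                         lookup (⋃V H) u ≡ false → occurrences H u ≡ 0
occurrences-outside-⋃V []      u _ = refl
occurrences-outside-⋃V (S ∷ H) u u∉ = cong₂ _+_
  (cong ⟦_⟧ (Bool.∨-conicalˡ _ _ u∉S∪⋃H)) (occurrences-outside-⋃V H u (Bool.∨-conicalʳ _ _ u∉S∪⋃H))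
  where
  u∉S∪⋃H : lookup S u ∨ lookup (⋃V H) u ≡ false
  u∉S∪⋃H = trans (sym (lookup-zipWith _ u S (⋃V H))) u∉

occurrences-∩-inside : ∀ {n} {W : Subset n} H u →
                       lookup W u ≡ true → occurrences (map (W ∩_) H) u ≡ occurrences H u
occurrences-∩-inside         []      u _   = refl
occurrences-∩-inside {W = W} (S ∷ H) u u∈W = cong₂ _+_
  (cong ⟦_⟧ (trans (lookup-zipWith _∧_ u W S) (cong (_∧ lookup S u) u∈W)))
  (occurrences-∩-inside H u u∈W)

occurrences-∩-outside : ∀ {n} {W : Subset n} H u →
                        lookup W u ≡ false → occurrences (map (W ∩_) H) u ≡ 0
occurrences-∩-outside         []      u _   = refl
occurrences-∩-outside {W = W} (S ∷ H) u u∉W = cong₂ _+_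
  (cong ⟦_⟧ (trans (lookup-zipWith _∧_ u W S) (cong (_∧ lookup S u) u∉W)))
  (occurrences-∩-outside H u u∉W)

double-counting : ∀ {n} d m (H : List (Subset n)) (U : Subset n) →
                  All (λ S → m ≤ ∣ S ∣) H → (∀ u → occurrences H u ≤ d * ⟦ lookup U u ⟧) →
                  length H * m ≤ d * ∣ U ∣
double-counting {n} d m H U large sparse = begin
  length H * m                     ≤⟨ ≤-∑-occurrences H large ⟩
  ∑[ u < n ] occurrences H u       ≤⟨ ∑-mono-≤ sparse ⟩
  ∑[ u < n ] (d * ⟦ lookup U u ⟧)  ≡⟨ *-distribˡ-sum {n} d (λ u → ⟦ lookup U u ⟧) ⟨
  d * ∑[ u < n ] ⟦ lookup U u ⟧    ≡⟨ cong (d *_) (∣∣≡∑ U) ⟨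
  d * ∣ U ∣                        ∎
  where
  open ≤-Reasoning
  ≤-∑-occurrences : ∀ H → All (λ S → m ≤ ∣ S ∣) H → length H * m ≤ ∑[ u < n ] occurrences H u
  ≤-∑-occurrences []      []              = z≤n
  ≤-∑-occurrences (S ∷ H) (m≤∣S∣ ∷ large) = begin
    m + length H * m                   ≤⟨ +-mono-≤ m≤∣S∣ (≤-∑-occurrences H large) ⟩
    ∣ S ∣ + ∑[ u < n ] occurrences H u  ≡⟨ cong (_+ _) (∣∣≡∑ S) ⟩
    ∑[ u < n ] ⟦ lookup S u ⟧ + ∑[ u < n ] occurrences H u
      ≡⟨ ∑-distrib-+ (λ u → ⟦ lookup S u ⟧) (occurrences H) ⟨
    ∑[ u < n ] occurrences (S ∷ H) u   ∎

double-counting⇒maxDensityLE :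
  ∀ {n} d m (W R : Subset n) (L : List (Subset n)) →
  (∀ u → lookup W u ≡ true → lookup R u ≡ false) →
  (∀ u → lookup W u ≡ true → occurrences L u ≤ d) →
  All (λ S → m ≤ ∣ W ∩ S ∣) L →
  MaxDensityLE L R d m
double-counting⇒maxDensityLE d m W R L W∩R≡∅ degree≤d large H H⊑L =
  subst (λ ℓ → ℓ * m ≤ d * ∣ ⋃V H ─ R ∣) (length-map (W ∩_) H)
        (double-counting d m (map (W ∩_) H) (⋃V H ─ R) (All.map⁺ (All-resp-⊆ H⊑L large)) sparse)
  where
  open ≤-Reasoning
  sparse : ∀ u → occurrences (map (W ∩_) H) u ≤ d * ⟦ lookup (⋃V H ─ R) u ⟧
  sparse u with lookup W u in u∈W
  ... | false = subst (_≤ _) (sym (occurrences-∩-outside H u u∈W)) z≤n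
  ... | true with lookup (⋃V H) u in u∈⋃H
  ...   | false = subst (_≤ _)
    (sym (trans (occurrences-∩-inside H u u∈W) (occurrences-outside-⋃V H u u∈⋃H))) z≤n
  ...   | true = begin
    occurrences (map (W ∩_) H) u  ≡⟨ occurrences-∩-inside H u u∈W ⟩
    occurrences H u               ≤⟨ occurrences-mono u H⊑L ⟩
    occurrences L u               ≤⟨ degree≤d u u∈W ⟩
    d                             ≡⟨ *-identityʳ d ⟨
    d * ⟦ true ⟧                  ≡⟨ cong (λ b → d * ⟦ b ⟧) u∈⋃H─R ⟨
    d * ⟦ lookup (⋃V H ─ R) u ⟧   ∎
    where
    u∈⋃H─R : lookup (⋃V H ─ R) u ≡ true
    u∈⋃H─R = trans (lookup-─ (⋃V H) R u (W∩R≡∅ u u∈W)) u∈⋃H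

module Booster (k : ℕ) where

  m p n : ℕ
  m = suc k
  p = suc m
  n = p + (2 + p * m)

  data V : Set where
    X    : Fin p → V
    apex : Bool → V
    W    : Fin p → Fin m → V

  enc : V → Fin n
  enc (X i)        = i ↑ˡ _
  enc (apex true)  = p ↑ʳ zero
  enc (apex false) = p ↑ʳ suc zero
  enc (W i r)      = p ↑ʳ suc (suc (combine i r))

  decʳ : Fin (2 + p * m) → V
  decʳ zero          = apex true
  decʳ (suc zero)    = apex false
  decʳ (suc (suc w)) = uncurry W (remQuot m w)

  dec : Fin n → V
  dec = [ X , decʳ ] ∘ splitAt p

  dec-enc : ∀ v → dec (enc v) ≡ v
  dec-enc (X i)        = cong [ X , decʳ ] (splitAt-↑ˡ p i _)
  dec-enc (apex true)  = cong [ X , decʳ ] (splitAt-↑ʳ p _ zero)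
  dec-enc (apex false) = cong [ X , decʳ ] (splitAt-↑ʳ p _ (suc zero))
  dec-enc (W i r)      = trans (cong [ X , decʳ ] (splitAt-↑ʳ p _ (suc (suc (combine i r)))))
                               (cong (uncurry W) (remQuot-combine i r))

  enc-dec : ∀ u → enc (dec u) ≡ u
  enc-dec u = trans (enc-[X,decʳ] (splitAt p u)) (join-splitAt p _ u)
    where
    enc-decʳ : ∀ j → enc (decʳ j) ≡ p ↑ʳ j
    enc-decʳ zero          = refl
    enc-decʳ (suc zero)    = refl
    enc-decʳ (suc (suc w)) = cong (λ j → p ↑ʳ suc (suc j)) (combine-remQuot {p} m w)
    enc-[X,decʳ] : ∀ s → enc ([ X , decʳ ] s) ≡ join p _ s
    enc-[X,decʳ] (inj₁ i) = refl
    enc-[X,decʳ] (inj₂ j) = enc-decʳ j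

  dec-injective : ∀ {u v} → dec u ≡ dec v → u ≡ v
  dec-injective {u} {v} eq = trans (sym (enc-dec u)) (trans (cong enc eq) (enc-dec v))

  -- Two grid cells are adjacent when they share exactly one coordinate; sharing both
  -- would be a loop, hence xor.
  adj : V → V → Bool
  adj (X i)    (X j)    = not (does (i ≟ j))
  adj (X i)    (W j _)  = does (i ≟ j)
  adj (W i _)  (X j)    = does (j ≟ i)
  adj (W i r)  (W j s)  = does (i ≟ j) xor does (r ≟ s)
  adj (apex _) (apex _) = false
  adj (X _)    (apex _) = true
  adj (apex _) (X _)    = true
  adj (apex _) (W _ _)  = true
  adj (W _ _)  (apex _) = true

  adj-sym : ∀ v w → adj v w ≡ adj w v
  adj-sym (X i)    (X j)    = cong not (does-≟-sym i j)
  adj-sym (X _)    (W _ _)  = refl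
  adj-sym (W _ _)  (X _)    = refl
  adj-sym (W i r)  (W j s)  = cong₂ _xor_ (does-≟-sym i j) (does-≟-sym r s)
  adj-sym (apex _) (apex _) = refl
  adj-sym (X _)    (apex _) = refl
  adj-sym (apex _) (X _)    = refl
  adj-sym (apex _) (W _ _)  = refl
  adj-sym (W _ _)  (apex _) = refl

  adj-irrefl : ∀ v → adj v v ≡ false
  adj-irrefl (X i)    = cong not (dec-true (i ≟ i) refl)
  adj-irrefl (apex _) = refl
  adj-irrefl (W i r)  = cong₂ _xor_ (dec-true (i ≟ i) refl) (dec-true (r ≟ r) refl)

  E : Fin n → Fin n → Bool
  E u v = adj (dec u) (dec v)

  isGraph : IsGraph E
  isGraph = record
    { symmetric   = λ u v uv → trans (adj-sym (dec v) (dec u)) uv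
    ; irreflexive = λ u uu → contradiction (trans (sym (adj-irrefl (dec u))) uu) λ ()
    }

  mk : (V → Bool) → Subset n
  mk P = tabulate (P ∘ dec)

  lookup-mk : ∀ P u → lookup (mk P) u ≡ P (dec u)
  lookup-mk P = lookup∘tabulate (P ∘ dec)

  lookup-mk-enc : ∀ P v → lookup (mk P) (enc v) ≡ P v
  lookup-mk-enc P v = trans (lookup-mk P (enc v)) (cong P (dec-enc v))

  ∈-mk⁺ : ∀ {P u} → P (dec u) ≡ true → u ∈ mk P
  ∈-mk⁺ {P} {u} Pu = lookup⇒[]= u (mk P) (trans (lookup-mk P u) Pu)

  ∈-mk⁻ : ∀ {P u} → u ∈ mk P → P (dec u) ≡ true
  ∈-mk⁻ {P} {u} u∈ = trans (sym (lookup-mk P u)) ([]=⇒lookup u∈)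

  mk-injective : ∀ {P Q} → mk P ≡ mk Q → ∀ v → P v ≡ Q v
  mk-injective {P} {Q} eq v = begin
    P v                   ≡⟨ lookup-mk-enc P v ⟨
    lookup (mk P) (enc v) ≡⟨ cong (λ S → lookup S (enc v)) eq ⟩
    lookup (mk Q) (enc v) ≡⟨ lookup-mk-enc Q v ⟩
    Q v                   ∎
    where open ≡-Reasoning

  IsCliqueᵛ : (V → Bool) → Set
  IsCliqueᵛ P = ∀ {v w} → P v ≡ true → P w ≡ true → v ≢ w → adj v w ≡ true

  isClique-mk : ∀ {P} → IsCliqueᵛ P → IsCliqueIn E (mk P)
  isClique-mk {P} clique u v u∈ v∈ u≢v =
    clique (∈-mk⁻ {P} u∈) (∈-mk⁻ {P} v∈) (u≢v ∘ dec-injective)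

  MeetOnlyAt : (V → Bool) → (V → Bool) → V → Set
  MeetOnlyAt P Q z = ∀ {v} → P v ≡ true → Q v ≡ true → v ≡ z

  edgeDisjoint-mk : ∀ {P Q z} → MeetOnlyAt P Q z → EdgeDisjoint (mk P) (mk Q)
  edgeDisjoint-mk {P} {Q} meet u v u≢v u∈P v∈P u∈Q v∈Q = u≢v (dec-injective
    (trans (meet (∈-mk⁻ {P} u∈P) (∈-mk⁻ {Q} u∈Q)) (sym (meet (∈-mk⁻ {P} v∈P) (∈-mk⁻ {Q} v∈Q)))))

  ∑X ∑W ∑V : (V → ℕ) → ℕ
  ∑X f = ∑[ i < p ] f (X i)
  ∑W f = ∑[ i < p ] ∑[ r < m ] f (W i r)
  ∑V f = ∑X f + (f (apex true) + (f (apex false) + ∑W f))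

  ∑V-cong : ∀ {f g} → (∀ v → f v ≡ g v) → ∑V f ≡ ∑V g
  ∑V-cong f≗g = cong₂ _+_ (sum-cong-≗ (f≗g ∘ X)) (cong₂ _+_ (f≗g (apex true))
    (cong₂ _+_ (f≗g (apex false)) (sum-cong-≗ (λ i → sum-cong-≗ (f≗g ∘ W i)))))

  ∑-enc : ∀ (g : Fin n → ℕ) → ∑[ u < n ] g u ≡ ∑V (g ∘ enc)
  ∑-enc g = trans (∑-↑ p _ g)
    (cong (λ t → ∑X (g ∘ enc) + (g (p ↑ʳ zero) + (g (p ↑ʳ suc zero) + t)))
          (∑-combine p m (λ w → g (p ↑ʳ suc (suc w)))))

  ∣∣≡∑V : ∀ S → ∣ S ∣ ≡ ∑V (λ v → ⟦ lookup S (enc v) ⟧)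
  ∣∣≡∑V S = trans (∣∣≡∑ S) (∑-enc (λ u → ⟦ lookup S u ⟧))

  ∣mk∣ : ∀ P → ∣ mk P ∣ ≡ ∑V (⟦_⟧ ∘ P)
  ∣mk∣ P = trans (∣∣≡∑V (mk P)) (∑V-cong (cong ⟦_⟧ ∘ lookup-mk-enc P))

  ∣mk∩mk∣ : ∀ P Q → ∣ mk P ∩ mk Q ∣ ≡ ∑V (λ v → ⟦ P v ∧ Q v ⟧)
  ∣mk∩mk∣ P Q = trans (∣∣≡∑V (mk P ∩ mk Q)) (∑V-cong λ v → cong ⟦_⟧
    (trans (lookup-zipWith _∧_ (enc v) (mk P) (mk Q)) (cong₂ _∧_ (lookup-mk-enc P v) (lookup-mk-enc Q v))))

  data Block : Set where
    hub : Block
    row : Fin p → Block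
    col : Fin m → Block

  lines blocks : List Block
  lines  = List.tabulate row ++ List.tabulate col
  blocks = hub ∷ lines

  block∈blocks : ∀ b → b Mem.∈ blocks
  block∈blocks hub     = Any.here refl
  block∈blocks (row x) = Any.there (∈-++⁺ˡ (∈-tabulate⁺ {f = row} x))
  block∈blocks (col r) = Any.there (∈-++⁺ʳ (List.tabulate row) (∈-tabulate⁺ {f = col} r))

  -- Decomposition c has hub X ∪ {apex c}; block b of it contains the single apex apexOf c b.
  apexOf : Bool → Block → Bool
  apexOf c hub     = c
  apexOf c (row _) = not c
  apexOf c (col _) = c

  block : Bool → Block → V → Bool
  block c b       (apex a) = does (a Bool.≟ apexOf c b)
  block c hub     (X _)    = true
  block c hub     (W _ _)  = false
  block c (row x) (X i)    = does (i ≟ x)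
  block c (row x) (W i _)  = does (i ≟ x)
  block c (col _) (X _)    = false
  block c (col r) (W _ s)  = does (s ≟ r)

  xCount wCount : Block → ℕ
  xCount hub     = p
  xCount (row _) = 1
  xCount (col _) = 0
  wCount hub     = 0
  wCount (row _) = m
  wCount (col _) = p

  ∑X-block : ∀ c b → ∑X (⟦_⟧ ∘ block c b) ≡ xCount b
  ∑X-block c hub     = ∑-const-1 p
  ∑X-block c (row x) = ∑-does-≟ x
  ∑X-block c (col _) = sum-replicate-zero p

  ∑W-block : ∀ c b → ∑W (⟦_⟧ ∘ block c b) ≡ wCount b
  ∑W-block c hub     = trans (sum-cong-≗ {p} (λ _ → sum-replicate-zero m)) (sum-replicate-zero p)
  ∑W-block c (row x) = trans (∑-comm {p} {m} (λ i _ → ⟦ does (i ≟ x) ⟧))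
                             (trans (sum-cong-≗ {m} (λ _ → ∑-does-≟ x)) (∑-const-1 m))
  ∑W-block c (col r) = trans (sum-cong-≗ {p} (λ _ → ∑-does-≟ r)) (∑-const-1 p)

  one-apex : ∀ a t → ⟦ does (true Bool.≟ a) ⟧ + (⟦ does (false Bool.≟ a) ⟧ + t) ≡ suc t
  one-apex true  t = refl
  one-apex false t = refl

  ∣block∣ : ∀ c b → ∣ mk (block c b) ∣ ≡ suc p
  ∣block∣ c b = begin
    ∣ mk (block c b) ∣         ≡⟨ ∣mk∣ (block c b) ⟩
    ∑V (⟦_⟧ ∘ block c b)       ≡⟨ cong₂ _+_ (∑X-block c b) (trans (one-apex (apexOf c b) _)
                                                                    (cong suc (∑W-block c b))) ⟩
    xCount b + suc (wCount b)  ≡⟨ size b ⟩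
    suc p                      ∎
    where
    open ≡-Reasoning
    size : ∀ b → xCount b + suc (wCount b) ≡ suc p
    size hub     = +-comm p 1
    size (row _) = refl
    size (col _) = refl

  block-isClique : ∀ c b → IsCliqueᵛ (block c b)
  block-isClique c b {apex a} {apex a′} a∈ a′∈ a≢a′ = ⊥-elim (a≢a′ (cong apex
    (trans (dec-true⁻ (a Bool.≟ _) a∈) (sym (dec-true⁻ (a′ Bool.≟ _) a′∈)))))
  block-isClique c b {X _}    {apex _} _ _ _ = refl
  block-isClique c b {apex _} {X _}    _ _ _ = refl
  block-isClique c b {apex _} {W _ _}  _ _ _ = refl
  block-isClique c b {W _ _}  {apex _} _ _ _ = refl
  block-isClique c hub {X i}   {X j}   _ _ Xi≢Xj = cong not (dec-false (i ≟ j) (Xi≢Xj ∘ cong X))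
  block-isClique c hub {X _}   {W _ _} _ () _
  block-isClique c hub {W _ _} {_}     () _ _
  block-isClique c (row x) {X i} {X j} i≡x j≡x Xi≢Xj =
    ⊥-elim (Xi≢Xj (cong X (trans (dec-true⁻ (i ≟ x) i≡x) (sym (dec-true⁻ (j ≟ x) j≡x)))))
  block-isClique c (row x) {X i} {W j _} i≡x j≡x _ =
    dec-true (i ≟ j) (trans (dec-true⁻ (i ≟ x) i≡x) (sym (dec-true⁻ (j ≟ x) j≡x)))
  block-isClique c (row x) {W i _} {X j} i≡x j≡x _ =
    dec-true (j ≟ i) (trans (dec-true⁻ (j ≟ x) j≡x) (sym (dec-true⁻ (i ≟ x) i≡x)))
  block-isClique c (row x) {W i r} {W j s} i≡x j≡x Wir≢Wjs =
    cong₂ _xor_ (dec-true (i ≟ j) i≡j) (dec-false (r ≟ s) (Wir≢Wjs ∘ cong₂ W i≡j))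
    where
    i≡j : i ≡ j
    i≡j = trans (dec-true⁻ (i ≟ x) i≡x) (sym (dec-true⁻ (j ≟ x) j≡x))
  block-isClique c (col r) {X _}   {_}     () _ _
  block-isClique c (col r) {W _ _} {X _}   _ () _
  block-isClique c (col r) {W i s} {W j t} s≡r t≡r Wis≢Wjt =
    cong₂ _xor_ (dec-false (i ≟ j) (λ i≡j → Wis≢Wjt (cong₂ W i≡j s≡t))) (dec-true (s ≟ t) s≡t)
    where
    s≡t : s ≡ t
    s≡t = trans (dec-true⁻ (s ≟ r) s≡r) (sym (dec-true⁻ (t ≟ r) t≡r))

  apex-clash : ∀ {a c} → does (a Bool.≟ c) ≡ true → does (a Bool.≟ not c) ≡ true → ⊥
  apex-clash {a} {c} a≡c a≡¬c =
    not-¬ refl (trans (sym (dec-true⁻ (a Bool.≟ c) a≡c)) (dec-true⁻ (a Bool.≟ not c) a≡¬c))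

  hub∩row : ∀ c x → MeetOnlyAt (block c hub) (block c (row x)) (X x)
  hub∩row c x {X i}    _   i≡x  = cong X (dec-true⁻ (i ≟ x) i≡x)
  hub∩row c x {apex a} a≡c a≡¬c = ⊥-elim (apex-clash {a} {c} a≡c a≡¬c)
  hub∩row c x {W _ _}  ()  _

  hub∩col : ∀ c r → MeetOnlyAt (block c hub) (block c (col r)) (apex c)
  hub∩col c r {X _}    _   ()
  hub∩col c r {apex a} a≡c _ = cong apex (dec-true⁻ (a Bool.≟ c) a≡c)
  hub∩col c r {W _ _}  ()  _

  row∩row : ∀ c {x y} → x ≢ y → MeetOnlyAt (block c (row x)) (block c (row y)) (apex (not c))
  row∩row c {x} {y} x≢y {X i}    i≡x i≡y =
    ⊥-elim (x≢y (trans (sym (dec-true⁻ (i ≟ x) i≡x)) (dec-true⁻ (i ≟ y) i≡y)))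
  row∩row c         x≢y {apex a} a≡¬c _  = cong apex (dec-true⁻ (a Bool.≟ not c) a≡¬c)
  row∩row c {x} {y} x≢y {W i _}  i≡x i≡y =
    ⊥-elim (x≢y (trans (sym (dec-true⁻ (i ≟ x) i≡x)) (dec-true⁻ (i ≟ y) i≡y)))

  col∩col : ∀ c {r s} → r ≢ s → MeetOnlyAt (block c (col r)) (block c (col s)) (apex c)
  col∩col c         r≢s {X _}    ()  _
  col∩col c         r≢s {apex a} a≡c _   = cong apex (dec-true⁻ (a Bool.≟ c) a≡c)
  col∩col c {r} {s} r≢s {W _ t}  t≡r t≡s =
    ⊥-elim (r≢s (trans (sym (dec-true⁻ (t ≟ r) t≡r)) (dec-true⁻ (t ≟ s) t≡s)))

  row∩col : ∀ c x r → MeetOnlyAt (block c (row x)) (block c (col r)) (W x r)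
  row∩col c x r {X _}    _    ()
  row∩col c x r {apex a} a≡¬c a≡c = ⊥-elim (apex-clash {a} {c} a≡c a≡¬c)
  row∩col c x r {W i s}  i≡x  s≡r = cong₂ W (dec-true⁻ (i ≟ x) i≡x) (dec-true⁻ (s ≟ r) s≡r)

  blocks-edgeDisjoint : ∀ c → AllPairs (EdgeDisjoint on (mk ∘ block c)) blocks
  blocks-edgeDisjoint c =
    All.++⁺ (All.tabulate⁺ (edgeDisjoint-mk ∘ hub∩row c)) (All.tabulate⁺ (edgeDisjoint-mk ∘ hub∩col c))
    ∷ AllPairs.++⁺ (AllPairs.tabulate⁺ (edgeDisjoint-mk ∘ row∩row c))
                   (AllPairs.tabulate⁺ (edgeDisjoint-mk ∘ col∩col c))
                   (All.tabulate⁺ λ x → All.tabulate⁺ (edgeDisjoint-mk ∘ row∩col c x))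

  apex-cases : ∀ c a → does (a Bool.≟ c) ≡ true ⊎ does (a Bool.≟ not c) ≡ true
  apex-cases c a with a Bool.≟ c
  ... | yes _   = inj₁ refl
  ... | no a≢c = inj₂ (dec-true (a Bool.≟ not c) (¬-not a≢c))

  edge-in-block : ∀ c {v w} → adj v w ≡ true → ∃ λ b → block c b v ≡ true × block c b w ≡ true
  edge-in-block c {X _}    {X _}    _   = hub , refl , refl
  edge-in-block c {X i}    {W j _}  i≡j = row j , i≡j , dec-true (j ≟ j) refl
  edge-in-block c {W i _}  {X j}    j≡i = row i , dec-true (i ≟ i) refl , j≡i
  edge-in-block c {W i r}  {W j s}  adj≡true with i ≟ j
  ... | yes i≡j = row j , dec-true (i ≟ j) i≡j , dec-true (j ≟ j) refl
  ... | no _    = col s , adj≡true , dec-true (s ≟ s) refl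
  edge-in-block c {apex _} {apex _} ()
  edge-in-block c {X i}    {apex a} _ with apex-cases c a
  ... | inj₁ a≡c  = hub , refl , a≡c
  ... | inj₂ a≡¬c = row i , dec-true (i ≟ i) refl , a≡¬c
  edge-in-block c {apex a} {X j}    _ with apex-cases c a
  ... | inj₁ a≡c  = hub , a≡c , refl
  ... | inj₂ a≡¬c = row j , a≡¬c , dec-true (j ≟ j) refl
  edge-in-block c {apex a} {W j r}  _ with apex-cases c a
  ... | inj₁ a≡c  = col r , a≡c , dec-true (r ≟ r) refl
  ... | inj₂ a≡¬c = row j , a≡¬c , dec-true (j ≟ j) refl
  edge-in-block c {W i r}  {apex a} _ with apex-cases c a
  ... | inj₁ a≡c  = col r , dec-true (r ≟ r) refl , a≡c
  ... | inj₂ a≡¬c = row i , dec-true (i ≟ i) refl , a≡¬c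

  decomposition : ∀ c → IsKqDecomposition (suc p) E (map (mk ∘ block c) blocks)
  decomposition c =
    All.map⁺ (universal (λ b → ∣block∣ c b , isClique-mk {block c b} (block-isClique c b)) blocks) ,
    AllPairs.map⁺ (blocks-edgeDisjoint c) ,
    λ u v uv → let b , u∈b , v∈b = edge-in-block c {dec u} {dec v} uv in
      Any.map⁺ (Mem.lose (block∈blocks b) (∈-mk⁺ {block c b} {u} u∈b , ∈-mk⁺ {block c b} {v} v∈b))

  false≢does-≟-refl : ∀ {a} (i : Fin a) → false ≢ does (i ≟ i)
  false≢does-≟-refl i eq = contradiction (trans eq (dec-true (i ≟ i) refl)) λ ()

  apex-differs : ∀ {c b c′ b′} → apexOf c b ≢ apexOf c′ b′ → ∃ λ v → block c b v ≢ block c′ b′ v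
  apex-differs {c} {b} {c′} {b′} a≢a′ = apex (apexOf c b) , λ eq → a≢a′
    (dec-true⁻ (apexOf c b Bool.≟ apexOf c′ b′) (trans (sym eq) (dec-true (apexOf c b Bool.≟ _) refl)))

  blocks-differ : ∀ c b b′ → ∃ λ v → block c b v ≢ block (not c) b′ v
  blocks-differ c hub     hub     = apex-differs (not-¬ refl)
  blocks-differ c hub     (col _) = apex-differs (not-¬ refl)
  blocks-differ c (col _) hub     = apex-differs (not-¬ refl)
  blocks-differ c (col _) (col _) = apex-differs (not-¬ refl)
  blocks-differ c (row _) (row _) = apex-differs (not-¬ refl)
  blocks-differ c hub     (row y) = W y zero , false≢does-≟-refl y
  blocks-differ c (col _) (row y) = X y , false≢does-≟-refl y
  blocks-differ c (row x) hub     = W x zero , ≢-sym (false≢does-≟-refl x)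
  blocks-differ c (row x) (col _) = X x , ≢-sym (false≢does-≟-refl x)

  S : Bool → Subset n
  S c = mk (block c hub)

  R : Bool → List (Subset n)
  R c = map (mk ∘ block c) lines

  disjointFamilies : ∀ c → DisjointFamilies (S c ∷ R c) (S (not c) ∷ R (not c))
  disjointFamilies c T T∈ T∈′ =
    let b  , _ , T≡b  = ∈-map⁻ (mk ∘ block c) {xs = blocks} T∈
        b′ , _ , T≡b′ = ∈-map⁻ (mk ∘ block (not c)) {xs = blocks} T∈′
        v  , differ   = blocks-differ c b b′
    in differ (mk-injective {block c b} {block (not c) b′} (trans (sym T≡b) T≡b′) v)

  ∣S∩S∣ : ∣ S true ∩ S false ∣ ≡ p
  ∣S∩S∣ = trans (∣mk∩mk∣ (block true hub) (block false hub))
                (trans (cong₂ _+_ (∑-const-1 p) (∑W-block true hub)) (+-identityʳ p))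

  inGrid : V → Bool
  inGrid (W _ _)  = true
  inGrid (X _)    = false
  inGrid (apex _) = false

  grid : Subset n
  grid = mk inGrid

  ∣grid∩block∣ : ∀ c b → ∣ grid ∩ mk (block c b) ∣ ≡ wCount b
  ∣grid∩block∣ c b =
    trans (∣mk∩mk∣ inGrid (block c b)) (cong₂ _+_ (sum-replicate-zero p) (∑W-block c b))

  R-large : ∀ c → All (λ T → m ≤ ∣ grid ∩ T ∣) (R c)
  R-large c = All.map⁺ (All.++⁺
    (All.tabulate⁺ λ x → ≤-reflexive (sym (∣grid∩block∣ c (row x))))
    (All.tabulate⁺ λ r → ≤-trans (n≤1+n m) (≤-reflexive (sym (∣grid∩block∣ c (col r))))))

  occurrences-R : ∀ c u → occurrences (R c) u ≡
                  ∑[ x < p ] ⟦ block c (row x) (dec u) ⟧ + ∑[ r < m ] ⟦ block c (col r) (dec u) ⟧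
  occurrences-R c u = begin
    occurrences (map f (List.tabulate row ++ List.tabulate col)) u
      ≡⟨ cong (λ L → occurrences L u) (map-++ f (List.tabulate row) (List.tabulate col)) ⟩
    occurrences (map f (List.tabulate row) ++ map f (List.tabulate col)) u
      ≡⟨ occurrences-++ (map f (List.tabulate row)) _ u ⟩
    occurrences (map f (List.tabulate row)) u + occurrences (map f (List.tabulate col)) u
      ≡⟨ cong₂ (λ L L′ → occurrences L u + occurrences L′ u) (map-tabulate row f) (map-tabulate col f) ⟩
    occurrences (List.tabulate (f ∘ row)) u + occurrences (List.tabulate (f ∘ col)) u
      ≡⟨ cong₂ _+_ (occurrences-tabulate (f ∘ row) u) (occurrences-tabulate (f ∘ col) u) ⟩
    ∑[ x < p ] ⟦ lookup (f (row x)) u ⟧ + ∑[ r < m ] ⟦ lookup (f (col r)) u ⟧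
      ≡⟨ cong₂ _+_ (sum-cong-≗ (λ x → cong ⟦_⟧ (lookup-mk (block c (row x)) u)))
                   (sum-cong-≗ (λ r → cong ⟦_⟧ (lookup-mk (block c (col r)) u))) ⟩
    ∑[ x < p ] ⟦ block c (row x) (dec u) ⟧ + ∑[ r < m ] ⟦ block c (col r) (dec u) ⟧
      ∎
    where
    open ≡-Reasoning
    f : Block → Subset n
    f = mk ∘ block c

  grid-degree : ∀ c u → lookup grid u ≡ true → occurrences (R c) u ≤ 2
  grid-degree c u u∈grid = ≤-reflexive
    (trans (occurrences-R c u) (row+col (dec u) (trans (sym (lookup-mk inGrid u)) u∈grid)))
    where
    row+col : ∀ v → inGrid v ≡ true →
              ∑[ x < p ] ⟦ block c (row x) v ⟧ + ∑[ r < m ] ⟦ block c (col r) v ⟧ ≡ 2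
    row+col (W i r) _ = cong₂ _+_ (∑-does-≟′ i) (∑-does-≟′ r)

  grid∩S : ∀ c u → lookup grid u ≡ true → lookup (S c) u ≡ false
  grid∩S c u u∈grid = trans (lookup-mk (block c hub) u)
    (outside-hub (dec u) (trans (sym (lookup-mk inGrid u)) u∈grid))
    where
    outside-hub : ∀ v → inGrid v ≡ true → block c hub v ≡ false
    outside-hub (W _ _) _ = refl

  grid∩S∪S : ∀ u → lookup grid u ≡ true → lookup (S true ∪ S false) u ≡ false
  grid∩S∪S u u∈grid = trans (lookup-zipWith _∨_ u (S true) (S false))
                            (cong₂ _∨_ (grid∩S true u u∈grid) (grid∩S false u u∈grid))

  density : ∀ c Z → (∀ u → lookup grid u ≡ true → lookup Z u ≡ false) → MaxDensityLE (R c) Z 2 m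
  density c Z grid∩Z≡∅ =
    double-counting⇒maxDensityLE 2 m grid Z (R c) grid∩Z≡∅ (grid-degree c) (R-large c)

lemma5p1 : (q : ℕ) → 2 < q →
    ∃ λ (n : ℕ) → Σ (Fin n → Fin n → Bool) λ E → IsGraph E ×
      Σ (Subset n) λ S₁ → Σ (List (Subset n)) λ R₁ →
      Σ (Subset n) λ S₂ → Σ (List (Subset n)) λ R₂ →
        IsKqDecomposition q E (S₁ ∷ R₁) ×
        IsKqDecomposition q E (S₂ ∷ R₂) ×
        DisjointFamilies (S₁ ∷ R₁) (S₂ ∷ R₂) ×
        ∣ S₁ ∩ S₂ ∣ ≡ q ∸ 1 ×
        MaxDensityLE R₁ S₁ 2 (q ∸ 2) ×
        MaxDensityLE R₂ (S₁ ∪ S₂) 2 (q ∸ 2)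
lemma5p1 (suc (suc (suc k))) _ =
  n , E , isGraph , S true , R true , S false , R false ,
  decomposition true , decomposition false , disjointFamilies true , ∣S∩S∣ ,
  density true (S true) (grid∩S true) , density false (S true ∪ S false) grid∩S∪S
  where open Booster k
lemma5p1 (suc zero)       (s≤s ())
lemma5p1 (suc (suc zero)) (s≤s (s≤s ()))
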